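{- Let $(G,k)$ be an instance of Diamond-free Edge Deletion (resp. $\{$Diamond, $K_t\}$-free Edge Deletion for fixed $t\ge4$), and let $C\subseteq V(G)$ induce a clique with at least $2k+2$ vertices in $G$. (i) No solution $S$ of size at most $k$ of $(G,k)$ contains an edge with both endpoints in $C$. (ii) If $C'\subseteq C$ is such that every vertex of $C'$ is local to $C$ in $G$, then every vertex set $D$ inducing a diamond in $G$ contains at most one vertex of $C'$.
   Context: A diamond is $K_4$ minus an edge. A solution of $(G,k)$ for Diamond-free Edge Deletion is a set $S\subseteq E(G)$ such that $G-S$ has no induced diamond; for the $\{$Diamond, $K_t\}$ version, $G-S$ must additionally contain no $K_t$. A vertex $v$ of a clique $C$ is local to $C$ in $G$ if $N(v)\subseteq C$. -}

module Defs where

open import Data.Nat using (ℕ; _≤_)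
open import Data.Fin using (Fin; _<_)
open import Data.Fin.Subset using (Subset; _∈_; _∩_; ∣_∣)
open import Data.Product using (_×_; _,_; ∃-syntax; Σ-syntax)
open import Data.List using (List; length)
open import Data.List.Relation.Unary.All using (All)
open import Data.List.Relation.Unary.Unique.Propositional using (Unique)
import Data.List.Membership.Propositional as LM
open import Relation.Binary.PropositionalEquality using (_≡_; _≢_)
open import Relation.Nullary using (¬_)

record Graph (n : ℕ) : Set₁ where
  field
    E      : Fin n → Fin n → Set
    sym    : ∀ {u v} → E u v → E v u
    irrefl : ∀ {u} → ¬ E u u
open Graph public

IsClique : ∀ {n} → Graph n → Subset n → Set
IsClique G C = ∀ u v → u ∈ C → v ∈ C → u ≢ v → E G u v

Local : ∀ {n} → Graph n → Subset n → Fin n → Set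
Local G C v = ∀ w → E G v w → w ∈ C

InducesDiamond : ∀ {n} → Graph n → Subset n → Set
InducesDiamond G D =
  ∣ D ∣ ≡ 4 ×
  ∃[ a ] ∃[ b ] ∃[ c ] ∃[ d ]
    (a ∈ D × b ∈ D × c ∈ D × d ∈ D ×
     a ≢ b × a ≢ c × a ≢ d × b ≢ c × b ≢ d × c ≢ d ×
     E G a b × E G a c × E G a d × E G b c × E G b d × ¬ E G c d)

DiamondFree : ∀ {n} → Graph n → Set
DiamondFree G = ∀ D → ¬ InducesDiamond G D

HasK : ∀ {n} → ℕ → Graph n → Set
HasK t G = Σ[ K ∈ Subset _ ] (∣ K ∣ ≡ t × IsClique G K)

data Problem : Set where
  diamond   : Problem
  diamondKt : (t : ℕ) → 4 ≤ t → Problem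

Free : ∀ {n} → Problem → Graph n → Set
Free diamond G = DiamondFree G
Free (diamondKt t _) G = DiamondFree G × ¬ HasK t G

-- An edge set S ⊆ E(G): each unordered edge {u,v} is listed exactly once
-- as the ordered pair (u , v) with u < v, so |S| = length of the list.
record EdgeSet {n} (G : Graph n) : Set where
  field
    edges   : List (Fin n × Fin n)
    ordered : All (λ p → Data.Product.proj₁ p < Data.Product.proj₂ p) edges
    unique  : Unique edges
    inG     : All (λ p → E G (Data.Product.proj₁ p) (Data.Product.proj₂ p)) edges
open EdgeSet public

size : ∀ {n} {G : Graph n} → EdgeSet G → ℕ
size S = length (edges S)

_─_ : ∀ {n} (G : Graph n) → EdgeSet G → Graph n
G ─ S = record
  { E = λ u v → E G u v × ¬ (u , v) LM.∈ edges S × ¬ (v , u) LM.∈ edges S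
  ; sym = λ { (e , p , q) → sym G e , q , p }
  ; irrefl = λ { (e , _) → irrefl G e }
  }

IsSmallSolution : ∀ {n} → Problem → (G : Graph n) → ℕ → EdgeSet G → Set
IsSmallSolution Π G k S = size S ≤ k × Free Π (G ─ S)

-- If a solution S of size at most k deleted an edge uv inside C, at most 2k
-- vertices of C would be endpoints of S, leaving two further vertices w, x of C
-- whose edges all survive; then {w, x, u, v} induces a diamond in G - S.
-- A diamond has exactly one non-adjacent pair c, d, while a vertex local to a
-- clique C has all its neighbours in C; a local vertex of a diamond is
-- therefore c or d, and c, d cannot both lie in the clique C.
module Submission where

open import Data.Nat using (ℕ; suc; _≤_; _<_; _+_; _*_; z≤n; s≤s)
open import Data.Nat.Properties
  using ( ≤-reflexive; ≤-trans; ≤-antisym; <-trans; <⇒≱; ≮⇒≥; n≤1+n; n<1+n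
        ; +-comm; +-suc; *-suc; +-monoʳ-≤; *-monoʳ-≤; module ≤-Reasoning)
open import Data.Fin using (Fin)
open import Data.Fin.Properties using (_≟_; any?)
open import Data.Fin.Subset
  using (Subset; inside; outside; _∈_; _⊆_; _∪_; _∩_; ⋃; ⁅_⁆; ∣_∣; _-_)
open import Data.Fin.Subset.Properties
  using ( _∈?_; x∈⁅x⁆; x∈p∪q⁺; x∈p∩q⁻; x∈p∧x≢y⇒x∈p-y; ∣⊥∣≡0; ∣⁅x⁆∣≡1
        ; x∈p⇒∣p-x∣<∣p∣; p⊆q⇒∣p∣≤∣q∣)
open import Data.Vec using ([]; _∷_)
open import Data.Product using (_×_; _,_; proj₁; proj₂; ∃-syntax)
open import Data.Sum using (inj₁; inj₂)
open import Data.List using (List; []; _∷_; length; map)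
open import Data.List.Relation.Unary.All as All using (All; []; _∷_)
open import Data.List.Relation.Unary.Any using (here; there) renaming (any? to anyₗ?)
open import Data.List.Relation.Unary.AllPairs using ([]; _∷_)
open import Data.List.Relation.Unary.Unique.Propositional using (Unique)
open import Data.List.Membership.Propositional using ()
  renaming (_∈_ to _∈ₗ_; _∉_ to _∉ₗ_)
open import Function using (_∘_)
open import Relation.Binary.PropositionalEquality
  using (_≡_; _≢_; refl; cong; ≢-sym; module ≡-Reasoning) renaming (sym to ≡-sym)
open import Relation.Nullary using (¬_; ¬?; _×-dec_; yes; no; contradiction)
open import Relation.Nullary.Decidable using (decidable-stable)
open import Defs

fromList : ∀ {n} → List (Fin n) → Subset n
fromList xs = ⋃ (map ⁅_⁆ xs)

∈ₗ⇒∈fromList : ∀ {n} {x : Fin n} {xs} → x ∈ₗ xs → x ∈ fromList xs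
∈ₗ⇒∈fromList (here refl) = x∈p∪q⁺ (inj₁ (x∈⁅x⁆ _))
∈ₗ⇒∈fromList (there x∈xs) = x∈p∪q⁺ (inj₂ (∈ₗ⇒∈fromList x∈xs))

All-∈fromList : ∀ {n} (xs : List (Fin n)) → All (_∈ fromList xs) xs
All-∈fromList xs = All.tabulate ∈ₗ⇒∈fromList

∣p∪q∣≤∣p∣+∣q∣ : ∀ {n} (p q : Subset n) → ∣ p ∪ q ∣ ≤ ∣ p ∣ + ∣ q ∣
∣p∪q∣≤∣p∣+∣q∣ []            []            = z≤n
∣p∪q∣≤∣p∣+∣q∣ (inside  ∷ p) (inside  ∷ q) =
  s≤s (≤-trans (∣p∪q∣≤∣p∣+∣q∣ p q) (+-monoʳ-≤ ∣ p ∣ (n≤1+n ∣ q ∣)))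
∣p∪q∣≤∣p∣+∣q∣ (inside  ∷ p) (outside ∷ q) = s≤s (∣p∪q∣≤∣p∣+∣q∣ p q)
∣p∪q∣≤∣p∣+∣q∣ (outside ∷ p) (inside  ∷ q) =
  ≤-trans (s≤s (∣p∪q∣≤∣p∣+∣q∣ p q)) (≤-reflexive (≡-sym (+-suc ∣ p ∣ ∣ q ∣)))
∣p∪q∣≤∣p∣+∣q∣ (outside ∷ p) (outside ∷ q) = ∣p∪q∣≤∣p∣+∣q∣ p q

∣fromList∣≤length : ∀ {n} (xs : List (Fin n)) → ∣ fromList xs ∣ ≤ length xs
∣fromList∣≤length {n} []       = ≤-reflexive (∣⊥∣≡0 n)
∣fromList∣≤length     (x ∷ xs) = begin
  ∣ ⁅ x ⁆ ∪ fromList xs ∣     ≤⟨ ∣p∪q∣≤∣p∣+∣q∣ ⁅ x ⁆ (fromList xs) ⟩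
  ∣ ⁅ x ⁆ ∣ + ∣ fromList xs ∣ ≡⟨ cong (_+ ∣ fromList xs ∣) (∣⁅x⁆∣≡1 x) ⟩
  suc ∣ fromList xs ∣         ≤⟨ s≤s (∣fromList∣≤length xs) ⟩
  suc (length xs)             ∎
  where open ≤-Reasoning

unique⇒length≤∣p∣ : ∀ {n} (p : Subset n) {xs} → Unique xs → All (_∈ p) xs → length xs ≤ ∣ p ∣
unique⇒length≤∣p∣ p []                  []              = z≤n
unique⇒length≤∣p∣ p {x ∷ xs} (x∉xs ∷ xs!) (x∈p ∷ xs⊆p) = begin-strict
  length xs     <⟨ s≤s (unique⇒length≤∣p∣ (p - x) xs! xs⊆p-x) ⟩
  suc ∣ p - x ∣ ≤⟨ x∈p⇒∣p-x∣<∣p∣ x∈p ⟩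
  ∣ p ∣         ∎
  where
  open ≤-Reasoning
  xs⊆p-x : All (_∈ p - x) xs
  xs⊆p-x = All.zipWith (λ (x≢y , y∈p) → x∈p∧x≢y⇒x∈p-y y∈p (≢-sym x≢y)) (x∉xs , xs⊆p)

unique⇒∣fromList∣≡length : ∀ {n} {xs : List (Fin n)} → Unique xs → ∣ fromList xs ∣ ≡ length xs
unique⇒∣fromList∣≡length {xs = xs} xs! =
  ≤-antisym (∣fromList∣≤length xs) (unique⇒length≤∣p∣ (fromList xs) xs! (All-∈fromList xs))

length<∣p∣⇒∃∉ : ∀ {n} (p : Subset n) (xs : List (Fin n)) → length xs < ∣ p ∣ → ∃[ x ] (x ∈ p × x ∉ₗ xs)
length<∣p∣⇒∃∉ p xs len<∣p∣ with any? (λ x → x ∈? p ×-dec ¬? (anyₗ? (x ≟_) xs))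
... | yes found = found
... | no none   = contradiction (≤-trans (p⊆q⇒∣p∣≤∣q∣ p⊆xs) (∣fromList∣≤length xs)) (<⇒≱ len<∣p∣)
  where
  p⊆xs : p ⊆ fromList xs
  p⊆xs {x} x∈p = ∈ₗ⇒∈fromList (decidable-stable (anyₗ? (x ≟_) xs) (λ x∉xs → none (x , x∈p , x∉xs)))

unique∧∣p∣≤length⇒∈ₗ : ∀ {n} {p : Subset n} {xs} → Unique xs → All (_∈ p) xs → ∣ p ∣ ≤ length xs →
                       ∀ {x} → x ∈ p → x ∈ₗ xs
unique∧∣p∣≤length⇒∈ₗ {p = p} {xs} xs! xs⊆p ∣p∣≤len {x} x∈p = decidable-stable (anyₗ? (x ≟_) xs) λ x∉xs →
  <⇒≱ (unique⇒length≤∣p∣ p (All.tabulate (λ { y∈xs refl → x∉xs y∈xs }) ∷ xs!) (x∈p ∷ xs⊆p)) ∣p∣≤len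

2+length≤∣p∣⇒∃₂∉ : ∀ {n} (p : Subset n) (xs : List (Fin n)) → 2 + length xs ≤ ∣ p ∣ →
                   ∃[ x ] ∃[ y ] (x ∈ p × y ∈ p × x ≢ y × x ∉ₗ xs × y ∉ₗ xs)
2+length≤∣p∣⇒∃₂∉ p xs 2+len≤∣p∣ with length<∣p∣⇒∃∉ p xs (<-trans (n<1+n _) 2+len≤∣p∣)
... | x , x∈p , x∉xs with length<∣p∣⇒∃∉ p (x ∷ xs) 2+len≤∣p∣
... | y , y∈p , y∉x∷xs =
  x , y , x∈p , y∈p , (λ { refl → y∉x∷xs (here refl) }) , x∉xs , y∉x∷xs ∘ there

endpoints : ∀ {n} → List (Fin n × Fin n) → List (Fin n)
endpoints []              = []
endpoints ((a , b) ∷ es) = a ∷ b ∷ endpoints es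

length-endpoints : ∀ {n} (es : List (Fin n × Fin n)) → length (endpoints es) ≡ 2 * length es
length-endpoints []       = refl
length-endpoints (_ ∷ es) = begin
  suc (suc (length (endpoints es))) ≡⟨ cong (suc ∘ suc) (length-endpoints es) ⟩
  suc (suc (2 * length es))         ≡⟨ *-suc 2 (length es) ⟨
  2 * suc (length es)               ∎
  where open ≡-Reasoning

∈-endpoints : ∀ {n} {a b : Fin n} {es} → (a , b) ∈ₗ es → a ∈ₗ endpoints es × b ∈ₗ endpoints es
∈-endpoints (here refl)     = here refl , there (here refl)
∈-endpoints {es = _ ∷ _} (there ab∈es) with ∈-endpoints ab∈es
... | a∈ , b∈ = there (there a∈) , there (there b∈)

∈-pair-distinct : ∀ {a p} {A : Set a} (P : A → Set p) {c d x y : A} →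
                  x ∈ₗ c ∷ d ∷ [] → y ∈ₗ c ∷ d ∷ [] → x ≢ y → P x → P y → P c × P d
∈-pair-distinct P (here refl)         (here refl)         x≢y = contradiction refl x≢y
∈-pair-distinct P (here refl)         (there (here refl)) _   px py = px , py
∈-pair-distinct P (there (here refl)) (here refl)         _   px py = py , px
∈-pair-distinct P (there (here refl)) (there (here refl)) x≢y = contradiction refl x≢y

Free⇒DiamondFree : ∀ {n} (Π : Problem) (G : Graph n) → Free Π G → DiamondFree G
Free⇒DiamondFree diamond          G free       = free
Free⇒DiamondFree (diamondKt _ _) G (free , _) = free

fromList-induces-diamond :
  ∀ {n} (G : Graph n) {a b c d : Fin n} →
  a ≢ b → a ≢ c → a ≢ d → b ≢ c → b ≢ d → c ≢ d →
  E G a b → E G a c → E G a d → E G b c → E G b d → ¬ E G c d →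
  InducesDiamond G (fromList (a ∷ b ∷ c ∷ d ∷ []))
fromList-induces-diamond G {a} {b} {c} {d} a≢b a≢c a≢d b≢c b≢d c≢d ab ac ad bc bd ¬cd
  with All-∈fromList (a ∷ b ∷ c ∷ d ∷ [])
... | a∈ ∷ b∈ ∷ c∈ ∷ d∈ ∷ [] =
  unique⇒∣fromList∣≡length distinct , a , b , c , d , a∈ , b∈ , c∈ , d∈ ,
  a≢b , a≢c , a≢d , b≢c , b≢d , c≢d , ab , ac , ad , bc , bd , ¬cd
  where
  distinct : Unique (a ∷ b ∷ c ∷ d ∷ [])
  distinct = (a≢b ∷ a≢c ∷ a≢d ∷ []) ∷ (b≢c ∷ b≢d ∷ []) ∷ (c≢d ∷ []) ∷ [] ∷ []

E─-untouched : ∀ {n} (G : Graph n) (S : EdgeSet G) {u v} →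
               E G u v → u ∉ₗ endpoints (edges S) → E (G ─ S) u v
E─-untouched G S uv u∉S =
  uv , (λ uv∈S → u∉S (proj₁ (∈-endpoints uv∈S))) , (λ vu∈S → u∉S (proj₂ (∈-endpoints vu∈S)))

deleted-clique-edge⇒diamond :
  ∀ {n} (G : Graph n) (C : Subset n) → IsClique G C → (S : EdgeSet G) →
  ∀ {u v w x} → (u , v) ∈ₗ edges S → u ∈ C → v ∈ C → w ∈ C → x ∈ C → w ≢ x →
  w ∉ₗ endpoints (edges S) → x ∉ₗ endpoints (edges S) →
  InducesDiamond (G ─ S) (fromList (w ∷ x ∷ u ∷ v ∷ []))
deleted-clique-edge⇒diamond G C clique S {u} {v} {w} {x} uv∈S u∈C v∈C w∈C x∈C w≢x w∉T x∉T =
  fromList-induces-diamond (G ─ S) w≢x w≢u w≢v x≢u x≢v u≢v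
    (survives w∈C x∈C w≢x w∉T) (survives w∈C u∈C w≢u w∉T) (survives w∈C v∈C w≢v w∉T)
    (survives x∈C u∈C x≢u x∉T) (survives x∈C v∈C x≢v x∉T) (λ (_ , uv∉S , _) → uv∉S uv∈S)
  where
  u∈T : u ∈ₗ endpoints (edges S)
  u∈T = proj₁ (∈-endpoints uv∈S)
  v∈T : v ∈ₗ endpoints (edges S)
  v∈T = proj₂ (∈-endpoints uv∈S)

  w≢u : w ≢ u
  w≢u refl = w∉T u∈T
  w≢v : w ≢ v
  w≢v refl = w∉T v∈T
  x≢u : x ≢ u
  x≢u refl = x∉T u∈T
  x≢v : x ≢ v
  x≢v refl = x∉T v∈T
  u≢v : u ≢ v
  u≢v refl = irrefl G (All.lookup (inG S) uv∈S)

  survives : ∀ {a b} → a ∈ C → b ∈ C → a ≢ b → a ∉ₗ endpoints (edges S) → E (G ─ S) a b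
  survives a∈C b∈C a≢b = E─-untouched G S (clique _ _ a∈C b∈C a≢b)

small-solution-avoids-clique :
  ∀ {n} (Π : Problem) (G : Graph n) (k : ℕ) (C : Subset n) →
  IsClique G C → 2 * k + 2 ≤ ∣ C ∣ →
  (S : EdgeSet G) → IsSmallSolution Π G k S →
  ∀ u v → (u , v) ∈ₗ edges S → ¬ (u ∈ C × v ∈ C)
small-solution-avoids-clique Π G k C clique big S (∣S∣≤k , free) u v uv∈S (u∈C , v∈C)
  with 2+length≤∣p∣⇒∃₂∉ C (endpoints (edges S)) 2+∣T∣≤∣C∣
  where
  2+∣T∣≤∣C∣ : 2 + length (endpoints (edges S)) ≤ ∣ C ∣
  2+∣T∣≤∣C∣ = begin
    2 + length (endpoints (edges S)) ≡⟨ cong (2 +_) (length-endpoints (edges S)) ⟩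
    2 + 2 * size S                   ≤⟨ +-monoʳ-≤ 2 (*-monoʳ-≤ 2 ∣S∣≤k) ⟩
    2 + 2 * k                        ≡⟨ +-comm 2 (2 * k) ⟩
    2 * k + 2                        ≤⟨ big ⟩
    ∣ C ∣                            ∎
    where open ≤-Reasoning
... | w , x , w∈C , x∈C , w≢x , w∉T , x∉T =
  Free⇒DiamondFree Π (G ─ S) free _
    (deleted-clique-edge⇒diamond G C clique S uv∈S u∈C v∈C w∈C x∈C w≢x w∉T x∉T)

diamond-meets-local-vertices-once :
  ∀ {n} (G : Graph n) (C : Subset n) → IsClique G C →
  (C' : Subset n) → C' ⊆ C → (∀ v → v ∈ C' → Local G C v) →
  ∀ D → InducesDiamond G D → ∣ D ∩ C' ∣ ≤ 1
diamond-meets-local-vertices-once G C clique C' C'⊆C local D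
  (∣D∣≡4 , a , b , c , d , a∈D , b∈D , c∈D , d∈D , a≢b , a≢c , a≢d , b≢c , b≢d , c≢d ,
   _ , ac , ad , bc , bd , ¬cd) = ≮⇒≥ ¬1<∣D∩C'∣
  where
  ¬cd⊆C : ¬ (c ∈ C × d ∈ C)
  ¬cd⊆C (c∈C , d∈C) = ¬cd (clique c d c∈C d∈C c≢d)

  ∈D⇒∈abcd : ∀ {z} → z ∈ D → z ∈ₗ a ∷ b ∷ c ∷ d ∷ []
  ∈D⇒∈abcd = unique∧∣p∣≤length⇒∈ₗ
    ((a≢b ∷ a≢c ∷ a≢d ∷ []) ∷ (b≢c ∷ b≢d ∷ []) ∷ (c≢d ∷ []) ∷ [] ∷ [])
    (a∈D ∷ b∈D ∷ c∈D ∷ d∈D ∷ []) (≤-reflexive ∣D∣≡4)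

  ∈D∩C'⇒∈cd : ∀ {z} → z ∈ D ∩ C' → z ∈ₗ c ∷ d ∷ []
  ∈D∩C'⇒∈cd {z} z∈D∩C' with x∈p∩q⁻ D C' z∈D∩C'
  ... | z∈D , z∈C' with ∈D⇒∈abcd z∈D
  ... | here refl          = contradiction (local z z∈C' c ac , local z z∈C' d ad) ¬cd⊆C
  ... | there (here refl)  = contradiction (local z z∈C' c bc , local z z∈C' d bd) ¬cd⊆C
  ... | there (there z∈cd) = z∈cd

  ∈D∩C'⇒∈C : ∀ {z} → z ∈ D ∩ C' → z ∈ C
  ∈D∩C'⇒∈C z∈D∩C' = C'⊆C (proj₂ (x∈p∩q⁻ D C' z∈D∩C'))

  ¬1<∣D∩C'∣ : ¬ (1 < ∣ D ∩ C' ∣)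
  ¬1<∣D∩C'∣ 1<∣D∩C'∣ with 2+length≤∣p∣⇒∃₂∉ (D ∩ C') [] 1<∣D∩C'∣
  ... | x , y , x∈ , y∈ , x≢y , _ =
    ¬cd⊆C (∈-pair-distinct (_∈ C) (∈D∩C'⇒∈cd x∈) (∈D∩C'⇒∈cd y∈) x≢y (∈D∩C'⇒∈C x∈) (∈D∩C'⇒∈C y∈))

lemma8 : ∀ {n} (Π : Problem) (G : Graph n) (k : ℕ) (C : Subset n) →
         IsClique G C → 2 * k + 2 ≤ ∣ C ∣ →
         ((S : EdgeSet G) → IsSmallSolution Π G k S →
            ∀ u v → (u , v) ∈ₗ edges S → ¬ (u ∈ C × v ∈ C))
         ×
         ((C' : Subset n) → C' ⊆ C → (∀ v → v ∈ C' → Local G C v) →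
            ∀ D → InducesDiamond G D → ∣ D ∩ C' ∣ ≤ 1)
lemma8 Π G k C clique big =
  small-solution-avoids-clique Π G k C clique big , diamond-meets-local-vertices-once G C clique
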